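{- For every positive integer $n$, $pd(K_{n,n})=\lceil n/2\rceil$, where $K_{n,n}$ is the complete bipartite graph with both parts of size $n$.
   Context: All graphs are simple, finite and undirected. For an edge-coloring $c$ of a graph $G$, a set $F\subseteq E(G)$ is a proper cut if $G-F$ is disconnected and any two edges of $F$ sharing an endpoint receive different colors. A proper cut $F$ separates two vertices $x,y$ if $x$ and $y$ lie in different components of $G-F$. An edge-colored graph is proper disconnected if for every pair of distinct vertices there is a proper cut separating them. For a connected graph $G$, the proper disconnection number $pd(G)$ is the minimum $k$ such that there is an edge-coloring $c:E(G)\to\{1,\dots,k\}$ making $G$ proper disconnected. -}

module Defs where

open import Data.Nat using (ℕ; _≤_)
open import Data.Fin using (Fin)
open import Data.Bool using (Bool; true; false; T)
open import Data.Sum using (_⊎_; inj₁; inj₂)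
open import Data.Product using (Σ; _×_; ∃)
open import Relation.Nullary using (¬_)
open import Relation.Binary.PropositionalEquality using (_≡_; _≢_)
open import Relation.Binary.Construct.Closure.ReflexiveTransitive using (Star)

record Graph : Set where
  field
    V      : ℕ
    adj    : Fin V → Fin V → Bool
    symm   : ∀ u v → adj u v ≡ adj v u
    irrefl : ∀ u → adj u u ≡ false

module _ (G : Graph) where
  open Graph G

  Edge : Fin V → Fin V → Set
  Edge u v = T (adj u v)

  -- An edge-coloring with colors {1..k} (represented by Fin k):
  -- a color for each edge, independent of the orientation.
  record Coloring (k : ℕ) : Set where
    field
      col     : (u v : Fin V) → Edge u v → Fin k
      col-sym : ∀ u v (e : Edge u v) (e' : Edge v u) → col u v e ≡ col v u e'

  -- A set of edges F ⊆ E(G), given as a symmetric predicate on ordered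
  -- pairs contained in the adjacency relation.
  record EdgeSet : Set₁ where
    field
      mem     : Fin V → Fin V → Set
      mem-sym : ∀ u v → mem u v → mem v u
      mem-edg : ∀ u v → mem u v → Edge u v

  Reach : EdgeSet → Fin V → Fin V → Set
  Reach F = Star (λ u v → Edge u v × ¬ EdgeSet.mem F u v)

  ProperSet : ∀ {k} → Coloring k → EdgeSet → Set
  ProperSet c F = ∀ u v w (e : Edge u v) (e' : Edge u w) →
    EdgeSet.mem F u v → EdgeSet.mem F u w → v ≢ w →
    Coloring.col c u v e ≢ Coloring.col c u w e'

  ProperCutSeparating : ∀ {k} → Coloring k → EdgeSet → Fin V → Fin V → Set
  ProperCutSeparating c F x y = ProperSet c F × ¬ Reach F x y

  ProperDisconnected : ∀ {k} → Coloring k → Set₁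
  ProperDisconnected c = ∀ x y → x ≢ y → Σ EdgeSet λ F → ProperCutSeparating c F x y

  HasPDColoring : ℕ → Set₁
  HasPDColoring k = Σ (Coloring k) ProperDisconnected

  PdIs : ℕ → Set₁
  PdIs k = HasPDColoring k × (∀ j → HasPDColoring j → k ≤ j)

-- Complete bipartite graph K_{m,n}: vertices Fin (m + n), the first m
-- form one part, the remaining n the other.
open import Data.Nat using (_+_; _<ᵇ_)
open import Data.Fin using (toℕ)
open import Data.Bool using (_xor_)
open import Data.Bool.Properties using (xor-same; xor-comm)

K : ℕ → ℕ → Graph
K m n = record
  { V = m + n
  ; adj = λ u v → (toℕ u <ᵇ m) xor (toℕ v <ᵇ m)
  ; symm = λ u v → xor-comm (toℕ u <ᵇ m) (toℕ v <ᵇ m)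
  ; irrefl = λ u → xor-same (toℕ u <ᵇ m)
  }

module Submission where

-- Given a labelling σ of the vertices by Bool, the edges
-- whose ends get different labels form a cut separating any two vertices
-- with different labels; the cut is proper as soon as two equally
-- coloured edges at a common vertex never end at distinct vertices with
-- equal labels.  For K_{m,n} with m, n ≤ 2k we colour an edge by the sum
-- of the positions of its ends (inside their parts) modulo k.  Edges at u
-- of the same colour then end at vertices with the same key (part,
-- position mod k); a key class has at most two vertices, a lower and an
-- upper one, and for any two distinct vertices x, y we choose σ so that
-- it separates x from y and the two members of every class.
--
-- If x ≠ y have n common neighbours b₁ … bₙ, a proper cut
-- separating x from y contains xbᵢ or ybᵢ for each i, and these n edges
-- have pairwise distinct (vertex, colour) tags in {x, y} × {1..j}, hence
-- n ≤ 2j.  In K_{n,n} (n ≥ 2) two vertices of one part have n common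
-- neighbours; K_{1,1} needs one colour because it has an edge.

open import Defs
open import Data.Nat
  using (ℕ; zero; suc; _+_; _*_; _∸_; _≤_; _<_; _<ᵇ_; z≤n; s≤s; ⌊_/2⌋; ⌈_/2⌉; NonZero; _≤?_)
open import Data.Nat.Properties
open import Data.Nat.DivMod using (_%_; %-distribˡ-+; [m+kn]%n≡m%n; m%n<n; m<n⇒m%n≡m; m≤n⇒[n∸m]%m≡n%m)
open import Data.Nat.Tactic.RingSolver using (solve-∀)
open import Data.Bool using (Bool; true; false; not; _xor_; if_then_else_; T)
import Data.Bool.Properties as Boolₚ
open import Data.Bool.Properties using (not-injective; ¬-not; xor-same; T-≡)
open import Data.Fin using (Fin; zero; suc; toℕ; fromℕ<; _↑ʳ_; join; splitAt)
open import Data.Fin.Properties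
  using (toℕ-injective; toℕ-fromℕ<; toℕ<n; ↑ʳ-injective; splitAt-join; injective⇒≤)
  renaming (_≟_ to _≟ᶠ_)
open import Data.Product using (Σ; _×_; _,_; proj₁; proj₂)
open import Data.Product.Properties using (≡-dec)
open import Data.Sum using (_⊎_; inj₁; inj₂)
import Data.Sum as Sum
open import Data.Sum.Properties using (inj₁-injective; inj₂-injective)
open import Data.Unit using (tt)
open import Function using (_∘_)
open import Function.Bundles using (Equivalence)
open import Function.Definitions using (Injective)
open import Relation.Nullary using (¬_; yes; no; contradiction)
open import Relation.Nullary.Negation using (¬¬-map)
open import Relation.Nullary.Decidable using (decidable-stable)
open import Relation.Nullary.Reflects using (ofʸ; ofⁿ; Reflects)
open import Relation.Binary.PropositionalEquality
  using (_≡_; _≢_; refl; sym; trans; cong; cong₂; subst; ≢-sym; module ≡-Reasoning)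
open import Relation.Binary.Definitions using (DecidableEquality)
open import Relation.Binary.Construct.Closure.ReflexiveTransitive using (ε; _◅_)

open ≡-Reasoning

xor-cancelˡ : ∀ a {b c} → a xor b ≡ a xor c → b ≡ c
xor-cancelˡ false eq = eq
xor-cancelˡ true  eq = not-injective eq

-- Two values both true under `a xor _` are equal: in a bipartite graph
-- all neighbours of a vertex lie in the same part.
T-xor-cancelˡ : ∀ a {b c} → T (a xor b) → T (a xor c) → b ≡ c
T-xor-cancelˡ a p q =
  xor-cancelˡ a (trans (Equivalence.to T-≡ p) (sym (Equivalence.to T-≡ q)))

not-xor-self : ∀ b → not b xor b ≡ true
not-xor-self false = refl
not-xor-self true  = refl

-- Double negation commutes with finite products: ¬¬ is a monad and Fin n
-- is finite.  Needed because membership in a cut is not decidable.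
¬¬-choice : ∀ {n} {P : Fin n → Set} → (∀ i → ¬ ¬ P i) → ¬ ¬ (∀ i → P i)
¬¬-choice {zero}  _ k = k λ ()
¬¬-choice {suc n} h k =
  h zero λ p₀ → ¬¬-choice (h ∘ suc) λ ps → k λ { zero → p₀ ; (suc i) → ps i }

%-congˡ-+ : ∀ a {b c k} .{{_ : NonZero k}} → b % k ≡ c % k → (a + b) % k ≡ (a + c) % k
%-congˡ-+ a {b} {c} {k} eq = begin
  (a + b) % k         ≡⟨ %-distribˡ-+ a b k ⟩
  (a % k + b % k) % k ≡⟨ cong (λ r → (a % k + r) % k) eq ⟩
  (a % k + c % k) % k ≡⟨ %-distribˡ-+ a c k ⟨
  (a + c) % k         ∎

%-undo-+ : ∀ a b k .{{_ : NonZero k}} → ((k ∸ 1) * a + (a + b)) % k ≡ b % k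
%-undo-+ a b (suc k) = begin
  (k * a + (a + b)) % suc k ≡⟨ cong (_% suc k) (rearrange k a b) ⟩
  (b + a * suc k) % suc k   ≡⟨ [m+kn]%n≡m%n b a (suc k) ⟩
  b % suc k                 ∎
  where
  rearrange : ∀ k a b → k * a + (a + b) ≡ b + a * suc k
  rearrange = solve-∀

%-cancelˡ-+ : ∀ a {b c k} .{{_ : NonZero k}} → (a + b) % k ≡ (a + c) % k → b % k ≡ c % k
%-cancelˡ-+ a {b} {c} {k} eq = begin
  b % k                       ≡⟨ %-undo-+ a b k ⟨
  ((k ∸ 1) * a + (a + b)) % k ≡⟨ %-congˡ-+ ((k ∸ 1) * a) eq ⟩
  ((k ∸ 1) * a + (a + c)) % k ≡⟨ %-undo-+ a c k ⟩
  c % k                       ∎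

%-upper-half : ∀ {i k} .{{_ : NonZero k}} → i < k + k → k ≤ i → i % k ≡ i ∸ k
%-upper-half {i} {k} i<2k k≤i = begin
  i % k       ≡⟨ m≤n⇒[n∸m]%m≡n%m k≤i ⟨
  (i ∸ k) % k ≡⟨ m<n⇒m%n≡m i∸k<k ⟩
  i ∸ k       ∎
  where
  i∸k<k : i ∸ k < k
  i∸k<k = subst (i ∸ k <_) (m+n∸m≡n k k) (∸-monoˡ-< i<2k k≤i)

half-residue-injective : ∀ {k i j} .{{_ : NonZero k}} → i < k + k → j < k + k →
  (i <ᵇ k) ≡ (j <ᵇ k) → i % k ≡ j % k → i ≡ j
half-residue-injective {k} {i} {j} i<2k j<2k same-half same-res
  with i <ᵇ k | <ᵇ-reflects-< i k | j <ᵇ k | <ᵇ-reflects-< j k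
... | true  | ofʸ i<k | true  | ofʸ j<k = begin
  i     ≡⟨ m<n⇒m%n≡m i<k ⟨
  i % k ≡⟨ same-res ⟩
  j % k ≡⟨ m<n⇒m%n≡m j<k ⟩
  j     ∎
... | false | ofⁿ i≮k | false | ofⁿ j≮k = ∸-cancelʳ-≡ k≤i k≤j (begin
  i ∸ k ≡⟨ %-upper-half i<2k k≤i ⟨
  i % k ≡⟨ same-res ⟩
  j % k ≡⟨ %-upper-half j<2k k≤j ⟩
  j ∸ k ∎)
  where
  k≤i = ≮⇒≥ i≮k
  k≤j = ≮⇒≥ j≮k
... | true  | _ | false | _ = contradiction same-half λ ()
... | false | _ | true  | _ = contradiction same-half λ ()

module Cuts (G : Graph) where
  open Graph G using (V; symm)

  edge-sym : ∀ {u v} → Edge G u v → Edge G v u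
  edge-sym {u} {v} = subst T (symm u v)

  colours-positive : ∀ {j} u v → Edge G u v → Coloring G j → 1 ≤ j
  colours-positive {zero}  u v e c with Coloring.col c u v e
  ... | ()
  colours-positive {suc j} _ _ _ _ = s≤s z≤n

  crossing : (Fin V → Bool) → EdgeSet G
  crossing σ = record
    { mem     = λ u v → Edge G u v × σ u ≢ σ v
    ; mem-sym = λ { u v (e , σu≢σv) → edge-sym e , ≢-sym σu≢σv }
    ; mem-edg = λ _ _ → proj₁
    }

  crossing-constant : ∀ σ {u v} → Reach G (crossing σ) u v → σ u ≡ σ v
  crossing-constant σ ε = refl
  crossing-constant σ {u} (_◅_ {j = w} (e , uncut) path) =
    trans (decidable-stable (σ u Boolₚ.≟ σ w) λ σu≢σw → uncut (e , σu≢σw))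
          (crossing-constant σ path)

  crossing-separates : ∀ σ {x y} → σ x ≢ σ y → ¬ Reach G (crossing σ) x y
  crossing-separates σ σx≢σy path = σx≢σy (crossing-constant σ path)

  SameColourSplits : ∀ {k} → Coloring G k → (Fin V → Bool) → Set
  SameColourSplits c σ = ∀ u v w (e : Edge G u v) (e' : Edge G u w) →
    Coloring.col c u v e ≡ Coloring.col c u w e' → σ v ≡ σ w → v ≡ w

  -- Crossing edges uv, uw both give v and w the label opposite to σ u.
  crossing-proper : ∀ {k} (c : Coloring G k) σ → SameColourSplits c σ → ProperSet G c (crossing σ)
  crossing-proper c σ splits u v w e e' (_ , σu≢σv) (_ , σu≢σw) v≢w same-colour =
    v≢w (splits u v w e e' same-colour (trans (¬-not (≢-sym σu≢σv)) (sym (¬-not (≢-sym σu≢σw)))))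

  splitting⇒proper-disconnected : ∀ {k} (c : Coloring G k) →
    (∀ x y → x ≢ y → Σ (Fin V → Bool) λ σ → σ x ≢ σ y × SameColourSplits c σ) →
    ProperDisconnected G c
  splitting⇒proper-disconnected c labelling x y x≢y with labelling x y x≢y
  ... | σ , σx≢σy , splits = crossing σ , crossing-proper c σ splits , crossing-separates σ σx≢σy

  -- A cut separating x from y contains an edge of every path x – z – y
  -- (up to double negation, as membership in F need not be decidable).
  cut-meets-path : ∀ (F : EdgeSet G) {x y z} → ¬ Reach G F x y →
    Edge G x z → Edge G z y → ¬ ¬ (EdgeSet.mem F x z ⊎ EdgeSet.mem F z y)
  cut-meets-path F separated xz zy neither =
    separated ((xz , neither ∘ inj₁) ◅ (zy , neither ∘ inj₂) ◅ ε)

  -- If x ≠ y have n common neighbours, a proper disconnected colouring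
  -- uses at least n/2 colours: the cut separating x from y contains xbᵢ or
  -- ybᵢ for each neighbour bᵢ, and properness makes the colours of these
  -- n edges distinct at x and at y.
  common-neighbours-bound : ∀ {n j x y} → x ≢ y →
    (b : Fin n → Fin V) → Injective _≡_ _≡_ b →
    (∀ i → Edge G x (b i)) → (∀ i → Edge G y (b i)) →
    HasPDColoring G j → n ≤ j + j
  common-neighbours-bound {n} {j} {x} {y} x≢y b b-injective xb yb (c , pd) =
    decidable-stable (n ≤? j + j) λ n≰2j →
      ¬¬-choice hit λ choice → n≰2j (injective⇒≤ (λ eq → tag-injective (choice _) (choice _) (join-injective eq)))
    where
    open Coloring c

    F : EdgeSet G
    F = proj₁ (pd x y x≢y)
    open EdgeSet F

    proper : ProperSet G c F
    proper = proj₁ (proj₂ (pd x y x≢y))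

    separated : ¬ Reach G F x y
    separated = proj₂ (proj₂ (pd x y x≢y))

    hit : ∀ i → ¬ ¬ (mem x (b i) ⊎ mem y (b i))
    hit i = ¬¬-map (Sum.map₂ (mem-sym (b i) y)) (cut-meets-path F separated (xb i) (edge-sym (yb i)))

    tag : ∀ i → mem x (b i) ⊎ mem y (b i) → Fin j ⊎ Fin j
    tag i (inj₁ _) = inj₁ (col x (b i) (xb i))
    tag i (inj₂ _) = inj₂ (col y (b i) (yb i))

    tag-injective : ∀ {i i'} p p' → tag i p ≡ tag i' p' → i ≡ i'
    tag-injective {i} {i'} (inj₁ xbᵢ) (inj₁ xbᵢ') eq = decidable-stable (i ≟ᶠ i') λ i≢i' →
      proper x (b i) (b i') (xb i) (xb i') xbᵢ xbᵢ' (i≢i' ∘ b-injective) (inj₁-injective eq)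
    tag-injective {i} {i'} (inj₂ ybᵢ) (inj₂ ybᵢ') eq = decidable-stable (i ≟ᶠ i') λ i≢i' →
      proper y (b i) (b i') (yb i) (yb i') ybᵢ ybᵢ' (i≢i' ∘ b-injective) (inj₂-injective eq)
    tag-injective (inj₁ _) (inj₂ _) ()
    tag-injective (inj₂ _) (inj₁ _) ()

    join-injective : ∀ {s t} → join j j s ≡ join j j t → s ≡ t
    join-injective {s} {t} eq = begin
      s                    ≡⟨ splitAt-join j j s ⟨
      splitAt j (join j j s) ≡⟨ cong (splitAt j) eq ⟩
      splitAt j (join j j t) ≡⟨ splitAt-join j j t ⟩
      t                    ∎

open Cuts

module Construction {m n k : ℕ} .{{_ : NonZero k}} (m≤2k : m ≤ k + k) (n≤2k : n ≤ k + k) where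

  Vertex : Set
  Vertex = Fin (m + n)

  part : Vertex → Bool
  part t = toℕ t <ᵇ m

  part-reflects : ∀ t → Reflects (toℕ t < m) (part t)
  part-reflects t = <ᵇ-reflects-< (toℕ t) m

  base : Bool → ℕ
  base p = if p then 0 else m

  pos : Vertex → ℕ
  pos t = toℕ t ∸ base (part t)

  base≤ : ∀ t → base (part t) ≤ toℕ t
  base≤ t with part t | part-reflects t
  ... | true  | _       = z≤n
  ... | false | ofⁿ t≮m = ≮⇒≥ t≮m

  pos<2k : ∀ t → pos t < k + k
  pos<2k t with part t | part-reflects t
  ... | true  | ofʸ t<m = <-≤-trans t<m m≤2k
  ... | false | ofⁿ t≮m =
    <-≤-trans (subst (toℕ t ∸ m <_) (m+n∸m≡n m n) (∸-monoˡ-< (toℕ<n t) (≮⇒≥ t≮m))) n≤2k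

  low : Vertex → Bool
  low t = pos t <ᵇ k

  -- The key of a vertex; each key class has at most two members, one low
  -- and one not.
  Key : Set
  Key = Bool × ℕ

  key : Vertex → Key
  key t = part t , pos t % k

  _≟ₖ_ : DecidableEquality Key
  _≟ₖ_ = ≡-dec Boolₚ._≟_ _≟_

  key-low-injective : ∀ {t t'} → key t ≡ key t' → low t ≡ low t' → t ≡ t'
  key-low-injective {t} {t'} same-key same-low = toℕ-injective (begin
    toℕ t                   ≡⟨ m+[n∸m]≡n (base≤ t) ⟨
    base (part t) + pos t   ≡⟨ cong₂ _+_ (cong base (cong proj₁ same-key)) same-pos ⟩
    base (part t') + pos t' ≡⟨ m+[n∸m]≡n (base≤ t') ⟩
    toℕ t'                  ∎)
    where
    same-pos : pos t ≡ pos t'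
    same-pos = half-residue-injective (pos<2k t) (pos<2k t') same-low (cong proj₂ same-key)

  residue : ℕ → Fin k
  residue s = fromℕ< (m%n<n s k)

  residue-injective : ∀ {a b} → residue a ≡ residue b → a % k ≡ b % k
  residue-injective {a} {b} eq = begin
    a % k            ≡⟨ toℕ-fromℕ< (m%n<n a k) ⟨
    toℕ (residue a)  ≡⟨ cong toℕ eq ⟩
    toℕ (residue b)  ≡⟨ toℕ-fromℕ< (m%n<n b k) ⟩
    b % k            ∎

  colouring : Coloring (K m n) k
  colouring = record
    { col     = λ u v _ → residue (pos u + pos v)
    ; col-sym = λ u v _ _ → cong residue (+-comm (pos u) (pos v))
    }

  same-colour⇒same-key : ∀ u v w (e : Edge (K m n) u v) (e' : Edge (K m n) u w) →
    Coloring.col colouring u v e ≡ Coloring.col colouring u w e' → key v ≡ key w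
  same-colour⇒same-key u v w e e' same-colour =
    cong₂ _,_ (T-xor-cancelˡ (part u) e e') (%-cancelˡ-+ (pos u) (residue-injective same-colour))

  module Sides (x y : Vertex) (x≢y : x ≢ y) where

    -- The label of the upper member of a key class; the lower member
    -- gets the opposite label.
    offset : Key → Bool
    offset c with c ≟ₖ key y | c ≟ₖ key x
    ... | yes _ | _     = low y
    ... | no _  | yes _ = not (low x)
    ... | no _  | no _  = false

    side : Vertex → Bool
    side v = offset (key v) xor low v

    offset-y : offset (key y) ≡ low y
    offset-y with key y ≟ₖ key y
    ... | yes _   = refl
    ... | no ¬refl = contradiction refl ¬refl

    -- If y shares the class of x it is its other member.
    offset-x : offset (key x) ≡ not (low x)
    offset-x with key x ≟ₖ key y | key x ≟ₖ key x
    ... | yes same | _      = ¬-not λ same-low → x≢y (sym (key-low-injective (sym same) same-low))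
    ... | no _     | yes _  = refl
    ... | no _     | no ¬refl = contradiction refl ¬refl

    side-separates : side x ≢ side y
    side-separates same = contradiction (begin
      true                 ≡⟨ not-xor-self (low x) ⟨
      not (low x) xor low x ≡⟨ cong (_xor low x) offset-x ⟨
      side x               ≡⟨ same ⟩
      side y               ≡⟨ cong (_xor low y) offset-y ⟩
      low y xor low y      ≡⟨ xor-same (low y) ⟩
      false                ∎) λ ()

    side-splits : SameColourSplits (K m n) colouring side
    side-splits u v w e e' same-colour same-side = key-low-injective same-key
      (xor-cancelˡ (offset (key v)) (trans same-side (cong (λ c → offset c xor low w) (sym same-key))))
      where
      same-key = same-colour⇒same-key u v w e e' same-colour

  K-pd-colouring : HasPDColoring (K m n) k
  K-pd-colouring = colouring , splitting⇒proper-disconnected (K m n) colouring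
    λ x y x≢y → let open Sides x y x≢y in side , side-separates , side-splits

↑ʳ-second-part : ∀ m {n} (i : Fin n) → (toℕ (m ↑ʳ i) <ᵇ m) ≡ false
↑ʳ-second-part zero    i = refl
↑ʳ-second-part (suc m) i = ↑ʳ-second-part m i

-- For m ≥ 2 the first two vertices of K m n have n common neighbours.
K-lower-bound : ∀ {m n j} → 2 ≤ m → HasPDColoring (K m n) j → n ≤ j + j
K-lower-bound {suc (suc m')} {n} _ =
  common-neighbours-bound (K m n) {x = zero} {y = suc zero} (λ ()) (m ↑ʳ_) (↑ʳ-injective m _ _)
    second-part second-part
  where
  m = suc (suc m')
  second-part : ∀ i → T (not (toℕ (m ↑ʳ i) <ᵇ m))
  second-part i = subst (T ∘ not) (sym (↑ʳ-second-part m i)) tt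
K-lower-bound {suc zero} (s≤s ())

Knn-lower-bound : ∀ {n j} → 1 ≤ n → HasPDColoring (K n n) j → n ≤ j + j
Knn-lower-bound {1}           {j} _ (c , _) = ≤-trans (colours-positive (K 1 1) zero (suc zero) tt c) (m≤m+n j j)
Knn-lower-bound {suc (suc _)}     _ pdc     = K-lower-bound (s≤s (s≤s z≤n)) pdc

n≤2⌈n/2⌉ : ∀ n → n ≤ ⌈ n /2⌉ + ⌈ n /2⌉
n≤2⌈n/2⌉ n = subst (_≤ ⌈ n /2⌉ + ⌈ n /2⌉) (⌊n/2⌋+⌈n/2⌉≡n n) (+-monoˡ-≤ ⌈ n /2⌉ (⌊n/2⌋≤⌈n/2⌉ n))

⌈n/2⌉-least : ∀ {n j} → n ≤ j + j → ⌈ n /2⌉ ≤ j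
⌈n/2⌉-least {n} {j} n≤2j = subst (⌈ n /2⌉ ≤_) (sym (n≡⌈n+n/2⌉ j)) (⌈n/2⌉-mono n≤2j)

theorem3p3 : (n : ℕ) → 1 ≤ n → PdIs (K n n) ⌈ n /2⌉
theorem3p3 n@(suc _) 1≤n =
  Construction.K-pd-colouring (n≤2⌈n/2⌉ n) (n≤2⌈n/2⌉ n) ,
  λ j pdc → ⌈n/2⌉-least (Knn-lower-bound 1≤n pdc)
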